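{- Let $G$ be a finite simple graph with $n$ vertices and $m$ edges. Any reduction sequence for $G$ chosen according to the preference rules described in the context reduces $G$ to the vertexless graph using at most $m/5$ III-reductions.
   Context: Graph reductions on a finite simple graph $H$: a 0-reduction on a vertex of degree 0 deletes it; a I-reduction on a vertex of degree 1 deletes it and its edge; a II-reduction on a vertex $y$ of degree 2 with neighbours $x,z$ deletes $y$ and its two edges and adds the edge $xz$ if it is not already present (parallel edges are identified, so the graph stays simple); a III-reduction on a vertex of degree at least 3 deletes it and its incident edges. A reduction sequence for $G$ is a sequence $v_1,\dots,v_n$ of its vertices with $G_0=G$ and $G_i$ obtained from $G_{i-1}$ by reducing on $v_i$ (the type determined by the degree of $v_i$ in $G_{i-1}$), ending with the vertexless graph $G_n$. The preference rules: $v_i$ is a vertex of degree 0 if one exists in $G_{i-1}$; otherwise of degree 1 if one exists; otherwise of degree 2 if one exists; otherwise of degree $\ge 5$ if one exists; otherwise of degree 4 if one exists; otherwise of degree 3. -}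

module Defs where

open import Data.Nat using (ℕ; zero; suc; _+_; _*_; _≤_; _<ᵇ_; _≡ᵇ_)
open import Data.Bool using (Bool; true; false; _∧_; _∨_; not; if_then_else_)
open import Data.Fin using (Fin; toℕ; _≟_)
open import Data.List using (List; []; _∷_; map; allFin)
open import Data.Nat.ListAction using (sum)
open import Data.Product using (_×_; ∃-syntax)
open import Relation.Nullary using (¬_; does)
open import Relation.Binary.PropositionalEquality using (_≡_)

-- A (current) simple graph whose vertex set is a subset of Fin n.
-- 'alive v' says v is still a vertex; 'adj' is the adjacency relation.
record Graph (n : ℕ) : Set where
  constructor mkGraph
  field
    alive : Fin n → Bool
    adj   : Fin n → Fin n → Bool
open Graph public

SimpleAdj : (n : ℕ) → (Fin n → Fin n → Bool) → Set
SimpleAdj n a = (∀ i j → a i j ≡ a j i) × (∀ i → a i i ≡ false)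

full : ∀ {n} → (Fin n → Fin n → Bool) → Graph n
full a = mkGraph (λ _ → true) a

b2n : Bool → ℕ
b2n true  = 1
b2n false = 0

deg : ∀ {n} → Graph n → Fin n → ℕ
deg {n} G v = sum (map (λ u → b2n (adj G v u)) (allFin n))

edgeCount : ∀ {n} → (Fin n → Fin n → Bool) → ℕ
edgeCount {n} a =
  sum (map (λ i → sum (map (λ j → b2n (a i j ∧ (toℕ i <ᵇ toℕ j))) (allFin n))) (allFin n))

eqF : ∀ {n} → Fin n → Fin n → Bool
eqF i j = does (i ≟ j)

-- reduction on v (type determined by deg v): delete v and its edges;
-- if deg v = 2 additionally join its two neighbours (no parallel edges: ∨).
reduce : ∀ {n} → Graph n → Fin n → Graph n
reduce G v = mkGraph
  (λ u → alive G u ∧ not (eqF u v))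
  (λ i j → not (eqF i v) ∧ not (eqF j v) ∧
     (adj G i j ∨ ((deg G v ≡ᵇ 2) ∧ adj G v i ∧ adj G v j ∧ not (eqF i j))))

Vertexless : ∀ {n} → Graph n → Set
Vertexless G = ∀ v → alive G v ≡ false

HasDeg : ∀ {n} → Graph n → ℕ → Set
HasDeg G d = ∃[ u ] (alive G u ≡ true × deg G u ≡ d)

HasDegGe5 : ∀ {n} → Graph n → Set
HasDegGe5 G = ∃[ u ] (alive G u ≡ true × 5 ≤ deg G u)

Preferred : ∀ {n} → Graph n → Fin n → Set
Preferred G v =
  alive G v ≡ true ×
  (HasDeg G 0 → deg G v ≡ 0) ×
  (¬ HasDeg G 0 → HasDeg G 1 → deg G v ≡ 1) ×
  (¬ HasDeg G 0 → ¬ HasDeg G 1 → HasDeg G 2 → deg G v ≡ 2) ×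
  (¬ HasDeg G 0 → ¬ HasDeg G 1 → ¬ HasDeg G 2 → HasDegGe5 G → 5 ≤ deg G v) ×
  (¬ HasDeg G 0 → ¬ HasDeg G 1 → ¬ HasDeg G 2 → ¬ HasDegGe5 G → HasDeg G 4 → deg G v ≡ 4) ×
  (¬ HasDeg G 0 → ¬ HasDeg G 1 → ¬ HasDeg G 2 → ¬ HasDegGe5 G → ¬ HasDeg G 4 → deg G v ≡ 3)

data PrefSeq {n : ℕ} : Graph n → List (Fin n) → Set where
  done : ∀ {G} → Vertexless G → PrefSeq G []
  step : ∀ {G v vs} → Preferred G v → PrefSeq (reduce G v) vs → PrefSeq G (v ∷ vs)

numIII : ∀ {n} → Graph n → List (Fin n) → ℕ
numIII G [] = 0
numIII G (v ∷ vs) = b2n (2 <ᵇ deg G v) + numIII (reduce G v) vs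

-- Weight a vertex of degree d by Ψ d: 0 for d ≤ 2, 5 for d = 3 and 2d for d ≥ 4, and let the
-- potential of a graph be the total weight.  As Ψ d ≤ 2d, the potential of G is at most
-- 2 · 2m = 4m.  No reduction raises a degree (a II-reduction trades the edge to the removed
-- vertex for at most one new edge), so the potential never increases.  The rules apply a
-- III-reduction to v of degree d only when every degree is at least 3 and, if d ≤ 4, d is the
-- maximum degree; then each of the d neighbours loses weight at least 5, 3 or 2 (for d = 3, 4
-- or d ≥ 5), so the potential falls by at least 5 + 3·5, 8 + 4·3 or 2d + 2d, i.e. by 20.
-- Hence 20 times the number of III-reductions is at most 4m.

module Submission where

open import Defs
open import Algebra.Bundles using (CommutativeMonoid)
open import Data.Bool using (Bool; true; false; _∧_; _∨_; not; if_then_else_; T)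
open import Data.Bool.Properties using (∧-zeroʳ; ∧-identityʳ; ∧-commutativeMonoid)
open import Data.Fin using (Fin; zero; suc; toℕ; _≟_)
open import Data.Fin.Properties using (toℕ-injective)
open import Data.List using (List; []; _∷_; map; allFin; tabulate)
open import Data.List.Properties using (map-tabulate)
open import Data.Nat using (ℕ; zero; suc; _+_; _*_; _≤_; _<_; _≤?_; z≤n; s≤s; _<ᵇ_; _≡ᵇ_)
open import Data.Nat.ListAction using (sum)
open import Data.Nat.Properties hiding (_≟_)
open import Data.Product using (_,_)
open import Data.Unit using (tt)
open import Data.Empty using (⊥; ⊥-elim)
open import Function using (_∘_)
open import Relation.Nullary using (¬_; Dec; yes; no; contradiction)
open import Relation.Nullary.Decidable using (dec-true; dec-false)
open import Relation.Binary.PropositionalEquality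
open import Algebra.Properties.Semiring.Sum +-*-semiring
  using (sum-syntax; sum-cong-≗; sum-replicate-zero; ∑-distrib-+; ∑-comm; *-distribˡ-sum)
open import Algebra.Properties.CommutativeSemigroup
  (CommutativeMonoid.commutativeSemigroup ∧-commutativeMonoid) using (x∙yz≈y∙xz)
open import Algebra.Properties.CommutativeSemigroup +-commutativeSemigroup using (xy∙z≈yz∙x)

∑-mono-≤ : ∀ {n} {f g : Fin n → ℕ} → (∀ i → f i ≤ g i) → ∑[ i < n ] f i ≤ ∑[ i < n ] g i
∑-mono-≤ {zero}  f≤g = z≤n
∑-mono-≤ {suc n} f≤g = +-mono-≤ (f≤g zero) (∑-mono-≤ (λ i → f≤g (suc i)))

sum-map-allFin : ∀ {n} (f : Fin n → ℕ) → sum (map f (allFin n)) ≡ ∑[ i < n ] f i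
sum-map-allFin {n} f = trans (cong sum (map-tabulate (λ i → i) f)) (sum-tabulate f)
  where
  sum-tabulate : ∀ {m} (g : Fin m → ℕ) → sum (tabulate g) ≡ ∑[ i < m ] g i
  sum-tabulate {zero}  g = refl
  sum-tabulate {suc m} g = cong (g zero +_) (sum-tabulate (λ i → g (suc i)))

eqF-refl : ∀ {n} (i : Fin n) → eqF i i ≡ true
eqF-refl i = dec-true (i ≟ i) refl

eqF-≢ : ∀ {n} {i j : Fin n} → i ≢ j → eqF i j ≡ false
eqF-≢ {i = i} {j} = dec-false (i ≟ j)

eqF-sym : ∀ {n} (i j : Fin n) → eqF i j ≡ eqF j i
eqF-sym i j with i ≟ j
... | yes refl = sym (eqF-refl i)
... | no i≢j   = sym (eqF-≢ (i≢j ∘ sym))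

single : ∀ {n} → Fin n → ℕ → Fin n → ℕ
single v x w = if eqF w v then x else 0

single-self : ∀ {n} (v : Fin n) x → single v x v ≡ x
single-self v x rewrite eqF-refl v = refl

single-≢ : ∀ {n} {v w : Fin n} x → w ≢ v → single v x w ≡ 0
single-≢ x w≢v rewrite eqF-≢ w≢v = refl

∑-single : ∀ {n} (v : Fin n) x → ∑[ w < n ] single v x w ≡ x
∑-single {suc n} zero    x = trans (cong (x +_) (sum-replicate-zero n)) (+-identityʳ x)
∑-single {suc n} (suc v) x = ∑-single v x

∑-single-≤ : ∀ {n} {f g : Fin n → ℕ} (v : Fin n) x →
             (∀ w → f w + single v x w ≤ g w) → ∑[ w < n ] f w + x ≤ ∑[ w < n ] g w
∑-single-≤ {n} {f} {g} v x le = begin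
  ∑[ w < n ] f w + x                          ≡⟨ cong (∑[ w < n ] f w +_) (∑-single v x) ⟨
  ∑[ w < n ] f w + ∑[ w < n ] single v x w    ≡⟨ ∑-distrib-+ f (single v x) ⟨
  ∑[ w < n ] (f w + single v x w)             ≤⟨ ∑-mono-≤ le ⟩
  ∑[ w < n ] g w                              ∎
  where open ≤-Reasoning

∧-≡-falseʳ : ∀ x {y} → y ≡ false → x ∧ y ≡ false
∧-≡-falseʳ x y≡false = trans (cong (x ∧_) y≡false) (∧-zeroʳ x)

b2n-∧-≤ˡ : ∀ x y → b2n (x ∧ y) ≤ b2n x
b2n-∧-≤ˡ true  true  = ≤-refl
b2n-∧-≤ˡ true  false = z≤n
b2n-∧-≤ˡ false y     = z≤n

b2n-∧-≤ʳ : ∀ x y → b2n (x ∧ y) ≤ b2n y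
b2n-∧-≤ʳ true  y = ≤-refl
b2n-∧-≤ʳ false y = z≤n

b2n-∨-≤ : ∀ x y → b2n (x ∨ y) ≤ b2n x + b2n y
b2n-∨-≤ true  y = s≤s z≤n
b2n-∨-≤ false y = ≤-refl

b2n-<ᵇ-≢ : ∀ {m n} → m ≢ n → b2n (m <ᵇ n) + b2n (n <ᵇ m) ≡ 1
b2n-<ᵇ-≢ {zero}  {zero}  m≢n = ⊥-elim (m≢n refl)
b2n-<ᵇ-≢ {zero}  {suc n} m≢n = refl
b2n-<ᵇ-≢ {suc m} {zero}  m≢n = refl
b2n-<ᵇ-≢ {suc m} {suc n} m≢n = b2n-<ᵇ-≢ (m≢n ∘ cong suc)

record IsSimple {n} (G : Graph n) : Set where
  field
    adj-sym       : ∀ i j → adj G i j ≡ adj G j i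
    adj-irrefl    : ∀ i → adj G i i ≡ false
    dead-isolated : ∀ {i} j → alive G i ≡ false → adj G i j ≡ false
open IsSimple

full-isSimple : ∀ {n} {a : Fin n → Fin n → Bool} → SimpleAdj n a → IsSimple (full a)
full-isSimple (sym-a , irrefl-a) = record
  { adj-sym = sym-a ; adj-irrefl = irrefl-a ; dead-isolated = λ _ () }

newEdge : ∀ {n} → Graph n → Fin n → Fin n → Fin n → Bool
newEdge G v u w = (deg G v ≡ᵇ 2) ∧ adj G v u ∧ adj G v w ∧ not (eqF u w)

newEdge-irrefl : ∀ {n} (G : Graph n) v u → newEdge G v u u ≡ false
newEdge-irrefl G v u =
  ∧-≡-falseʳ (deg G v ≡ᵇ 2) (∧-≡-falseʳ (adj G v u) (∧-≡-falseʳ (adj G v u) (cong not (eqF-refl u))))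

newEdge-nonII : ∀ {n} (G : Graph n) v u w → (deg G v ≡ᵇ 2) ≡ false → newEdge G v u w ≡ false
newEdge-nonII G v u w nonII = cong (_∧ (adj G v u ∧ adj G v w ∧ not (eqF u w))) nonII

adj-reduce-removedʳ : ∀ {n} (G : Graph n) v u → adj (reduce G v) u v ≡ false
adj-reduce-removedʳ G v u rewrite eqF-refl v = ∧-zeroʳ (not (eqF u v))

adj-reduce-removedˡ : ∀ {n} (G : Graph n) v w → adj (reduce G v) v w ≡ false
adj-reduce-removedˡ G v w rewrite eqF-refl v = refl

reduce-isSimple : ∀ {n} {G : Graph n} v → IsSimple G → IsSimple (reduce G v)
adj-sym (reduce-isSimple {G = G} v S) i j = begin
  not (eqF i v) ∧ not (eqF j v) ∧ (adj G i j ∨ newEdge G v i j)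
    ≡⟨ x∙yz≈y∙xz (not (eqF i v)) (not (eqF j v)) _ ⟩
  not (eqF j v) ∧ not (eqF i v) ∧ (adj G i j ∨ newEdge G v i j)
    ≡⟨ cong (λ e → not (eqF j v) ∧ not (eqF i v) ∧ e) (cong₂ _∨_ (adj-sym S i j) newEdge-sym) ⟩
  not (eqF j v) ∧ not (eqF i v) ∧ (adj G j i ∨ newEdge G v j i) ∎
  where
  open ≡-Reasoning
  newEdge-sym : newEdge G v i j ≡ newEdge G v j i
  newEdge-sym = cong ((deg G v ≡ᵇ 2) ∧_)
    (trans (x∙yz≈y∙xz (adj G v i) (adj G v j) (not (eqF i j)))
           (cong (λ b → adj G v j ∧ adj G v i ∧ not b) (eqF-sym i j)))
adj-irrefl (reduce-isSimple {G = G} v S) i = ∧-≡-falseʳ (not (eqF i v))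
  (∧-≡-falseʳ (not (eqF i v)) (cong₂ _∨_ (adj-irrefl S i) (newEdge-irrefl G v i)))
dead-isolated (reduce-isSimple {G = G} v S) {i} j dead with eqF i v
... | true  = refl
... | false =
  ∧-≡-falseʳ true (∧-≡-falseʳ (not (eqF j v)) (cong₂ _∨_ (dead-isolated S j deadG) newEdge-dead))
  where
  deadG : alive G i ≡ false
  deadG = trans (sym (∧-identityʳ (alive G i))) dead
  newEdge-dead : newEdge G v i j ≡ false
  newEdge-dead = ∧-≡-falseʳ (deg G v ≡ᵇ 2)
    (cong (_∧ (adj G v j ∧ not (eqF i j))) (trans (adj-sym S v i) (dead-isolated S v deadG)))

deg≡∑ : ∀ {n} (G : Graph n) u → deg G u ≡ ∑[ w < n ] b2n (adj G u w)
deg≡∑ G u = sum-map-allFin (λ w → b2n (adj G u w))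

∑-b2n-false : ∀ {n} (f : Fin n → Bool) → (∀ w → f w ≡ false) → ∑[ w < n ] b2n (f w) ≡ 0
∑-b2n-false {n} f f≡false = trans (sum-cong-≗ (λ w → cong b2n (f≡false w))) (sum-replicate-zero n)

deg-reduce-removed : ∀ {n} (G : Graph n) v → deg (reduce G v) v ≡ 0
deg-reduce-removed G v =
  trans (deg≡∑ (reduce G v) v) (∑-b2n-false _ (adj-reduce-removedˡ G v))

deg-reduce : ∀ {n} (G : Graph n) v u →
             deg (reduce G v) u + b2n (adj G u v) ≤ deg G u + ∑[ w < n ] b2n (newEdge G v u w)
deg-reduce {n} G v u = begin
  deg (reduce G v) u + b2n (adj G u v)
    ≡⟨ cong (_+ b2n (adj G u v)) (deg≡∑ (reduce G v) u) ⟩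
  ∑[ w < n ] b2n (adj (reduce G v) u w) + b2n (adj G u v)
    ≤⟨ ∑-single-≤ v (b2n (adj G u v)) edgewise ⟩
  ∑[ w < n ] (b2n (adj G u w) + b2n (newEdge G v u w))
    ≡⟨ ∑-distrib-+ (λ w → b2n (adj G u w)) (λ w → b2n (newEdge G v u w)) ⟩
  ∑[ w < n ] b2n (adj G u w) + ∑[ w < n ] b2n (newEdge G v u w)
    ≡⟨ cong (_+ ∑[ w < n ] b2n (newEdge G v u w)) (deg≡∑ G u) ⟨
  deg G u + ∑[ w < n ] b2n (newEdge G v u w) ∎
  where
  open ≤-Reasoning
  edgewise : ∀ w → b2n (adj (reduce G v) u w) + single v (b2n (adj G u v)) w
                   ≤ b2n (adj G u w) + b2n (newEdge G v u w)
  edgewise w with w ≟ v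
  ... | yes refl rewrite ∧-zeroʳ (not (eqF u w)) = m≤m+n (b2n (adj G u w)) _
  ... | no _ = ≤-trans (≤-reflexive (+-identityʳ _))
    (≤-trans (b2n-∧-≤ʳ (not (eqF u v)) _) (b2n-∨-≤ (adj G u w) (newEdge G v u w)))

∑-others+1≤deg : ∀ {n} (G : Graph n) v u → adj G v u ≡ true →
                 ∑[ w < n ] b2n (adj G v w ∧ not (eqF u w)) + 1 ≤ deg G v
∑-others+1≤deg {n} G v u v∼u =
  subst (∑[ w < n ] b2n (adj G v w ∧ not (eqF u w)) + 1 ≤_) (sym (deg≡∑ G v))
    (∑-single-≤ u 1 edgewise)
  where
  edgewise : ∀ w → b2n (adj G v w ∧ not (eqF u w)) + single u 1 w ≤ b2n (adj G v w)
  edgewise w with w ≟ u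
  ... | yes refl rewrite eqF-refl u | ∧-zeroʳ (adj G v u) | v∼u = ≤-refl
  ... | no _ = ≤-trans (≤-reflexive (+-identityʳ _)) (b2n-∧-≤ˡ (adj G v w) (not (eqF u w)))

∑-newEdge≤ : ∀ {n} (G : Graph n) v u → ∑[ w < n ] b2n (newEdge G v u w) ≤ b2n (adj G v u)
∑-newEdge≤ {n} G v u with deg G v ≡ᵇ 2 in isII | adj G v u in v∼u
... | false | _     = ≤-trans (≤-reflexive (sum-replicate-zero n)) z≤n
... | true  | false = ≤-reflexive (sum-replicate-zero n)
... | true  | true  = +-cancelʳ-≤ 1 _ 1
  (subst (∑[ w < n ] b2n (adj G v w ∧ not (eqF u w)) + 1 ≤_)
         (≡ᵇ⇒≡ (deg G v) 2 (subst T (sym isII) tt)) (∑-others+1≤deg G v u v∼u))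

deg-reduce-nonII : ∀ {n} (G : Graph n) v → (deg G v ≡ᵇ 2) ≡ false → ∀ u →
                   deg (reduce G v) u + b2n (adj G u v) ≤ deg G u
deg-reduce-nonII G v nonII u = subst (deg (reduce G v) u + b2n (adj G u v) ≤_)
  (trans (cong (deg G u +_) (∑-b2n-false _ (λ w → newEdge-nonII G v u w nonII)))
         (+-identityʳ (deg G u)))
  (deg-reduce G v u)

deg-reduce-≤ : ∀ {n} {G : Graph n} v → IsSimple G → ∀ u → deg (reduce G v) u ≤ deg G u
deg-reduce-≤ {G = G} v S u = +-cancelʳ-≤ (b2n (adj G u v)) _ _ (begin
  deg (reduce G v) u + b2n (adj G u v)            ≤⟨ deg-reduce G v u ⟩
  deg G u + ∑[ w < _ ] b2n (newEdge G v u w)      ≤⟨ +-monoʳ-≤ (deg G u) (∑-newEdge≤ G v u) ⟩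
  deg G u + b2n (adj G v u)                       ≡⟨ cong (λ b → deg G u + b2n b) (adj-sym S v u) ⟩
  deg G u + b2n (adj G u v)                       ∎)
  where open ≤-Reasoning

Ψ : ℕ → ℕ
Ψ 0 = 0
Ψ 1 = 0
Ψ 2 = 0
Ψ 3 = 5
Ψ d@(suc (suc (suc (suc _)))) = 2 * d

Ψ-mono : ∀ {m n} → m ≤ n → Ψ m ≤ Ψ n
Ψ-mono {0} _ = z≤n
Ψ-mono {1} _ = z≤n
Ψ-mono {2} _ = z≤n
Ψ-mono {3} (s≤s (s≤s (s≤s {n = 0} z≤n))) = ≤-refl
Ψ-mono {3} (s≤s (s≤s (s≤s {n = suc l} z≤n))) = ≤-trans (m≤m+n 5 3) (*-monoʳ-≤ 2 (m≤m+n 4 l))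
Ψ-mono {suc (suc (suc (suc _)))} m≤n@(s≤s (s≤s (s≤s (s≤s _)))) = *-monoʳ-≤ 2 m≤n

Ψ≤2* : ∀ d → Ψ d ≤ 2 * d
Ψ≤2* 0 = z≤n
Ψ≤2* 1 = z≤n
Ψ≤2* 2 = z≤n
Ψ≤2* 3 = m≤m+n 5 1
Ψ≤2* (suc (suc (suc (suc _)))) = ≤-refl

gain : ℕ → ℕ
gain 3 = 5
gain 4 = 3
gain _ = 2

Ψ-gain : ∀ {d} → 3 ≤ d → 20 ≤ Ψ d + gain d * d
Ψ-gain {1} (s≤s ())
Ψ-gain {2} (s≤s (s≤s ()))
Ψ-gain {3} _ = ≤-refl
Ψ-gain {4} _ = ≤-refl
Ψ-gain {suc (suc (suc (suc (suc m))))} _ = +-mono-≤ 2*d≥10 2*d≥10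
  where
  2*d≥10 : 10 ≤ 2 * (5 + m)
  2*d≥10 = *-monoʳ-≤ 2 (m≤m+n 5 m)

gain≤Ψ-step : ∀ {d k} → 3 ≤ d → 2 ≤ k → (d < 5 → k < d) → Ψ k + gain d ≤ Ψ (suc k)
gain≤Ψ-step {1} (s≤s ()) _ _
gain≤Ψ-step {2} (s≤s (s≤s ())) _ _
gain≤Ψ-step {k = 1} _ (s≤s ()) _
gain≤Ψ-step {3} {2} _ _ _ = ≤-refl
gain≤Ψ-step {4} {2} _ _ _ = m≤m+n 3 2
gain≤Ψ-step {4} {3} _ _ _ = ≤-refl
gain≤Ψ-step {suc (suc (suc (suc (suc _))))} {2} _ _ _ = m≤m+n 2 3
gain≤Ψ-step {suc (suc (suc (suc (suc _))))} {3} _ _ _ = m≤m+n 7 1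
gain≤Ψ-step {suc (suc (suc (suc (suc _))))} {k@(suc (suc (suc (suc _))))} _ _ _ =
  ≤-reflexive (trans (+-comm (2 * k) 2) (sym (*-suc 2 k)))
gain≤Ψ-step {3} {suc (suc (suc _))} _ _ k<d with k<d (s≤s (s≤s (s≤s (s≤s z≤n))))
... | s≤s (s≤s (s≤s ()))
gain≤Ψ-step {4} {suc (suc (suc (suc _)))} _ _ k<d with k<d (s≤s (s≤s (s≤s (s≤s (s≤s z≤n)))))
... | s≤s (s≤s (s≤s (s≤s ())))

gain≤Ψ-drop : ∀ {d k m} → 3 ≤ d → 3 ≤ m → (d < 5 → m ≤ d) → k < m → Ψ k + gain d ≤ Ψ m
gain≤Ψ-drop {d} {m = suc j} 3≤d 3≤m m≤d k<m =
  ≤-trans (+-monoˡ-≤ (gain d) (Ψ-mono (≤-pred k<m))) (gain≤Ψ-step 3≤d (≤-pred 3≤m) m≤d)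

potential : ∀ {n} → Graph n → ℕ
potential {n} G = ∑[ u < n ] Ψ (deg G u)

potential-reduce-≤ : ∀ {n} {G : Graph n} v → IsSimple G → potential (reduce G v) ≤ potential G
potential-reduce-≤ v S = ∑-mono-≤ (λ u → Ψ-mono (deg-reduce-≤ v S u))

neighbour-alive : ∀ {n} {G : Graph n} {v u} → IsSimple G → adj G v u ≡ true → alive G u ≡ true
neighbour-alive {G = G} {v} {u} S v∼u with alive G u in u-alive
... | true  = refl
... | false = contradiction (trans (sym v∼u) (trans (adj-sym S v u) (dead-isolated S v u-alive))) λ ()

3≤⇒≡ᵇ2-false : ∀ {m} → 3 ≤ m → (m ≡ᵇ 2) ≡ false
3≤⇒≡ᵇ2-false (s≤s (s≤s (s≤s _))) = refl

no-low-degree : ∀ {n} {G : Graph n} {v} → Preferred G v → 3 ≤ deg G v →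
                ∀ {k} → k < 3 → ¬ HasDeg G k
no-low-degree {G = G} {v} (_ , p0 , p1 , p2 , _) 3≤d = absent
  where
  too-low : ∀ {k} → deg G v ≡ k → k < 3 → ⊥
  too-low d≡k k<3 = <⇒≱ k<3 (subst (3 ≤_) d≡k 3≤d)
  no0 : ¬ HasDeg G 0
  no0 h = too-low (p0 h) (s≤s z≤n)
  no1 : ¬ HasDeg G 1
  no1 h = too-low (p1 no0 h) (s≤s (s≤s z≤n))
  absent : ∀ {k} → k < 3 → ¬ HasDeg G k
  absent {0} _ = no0
  absent {1} _ = no1
  absent {2} _ h = too-low (p2 no0 no1 h) ≤-refl
  absent {suc (suc (suc _))} (s≤s (s≤s (s≤s ())))

min-degree : ∀ {n} {G : Graph n} {v u} → Preferred G v → 3 ≤ deg G v →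
             alive G u ≡ true → 3 ≤ deg G u
min-degree {G = G} {u = u} pref 3≤d u-alive with 3 ≤? deg G u
... | yes 3≤du = 3≤du
... | no 3≰du  = ⊥-elim (no-low-degree pref 3≤d (≰⇒> 3≰du) (u , u-alive , refl))

max-degree : ∀ {n} {G : Graph n} {v u} → Preferred G v → 3 ≤ deg G v → deg G v < 5 →
             alive G u ≡ true → deg G u ≤ deg G v
max-degree {G = G} {v} {u} pref@(_ , _ , _ , _ , p5 , p4 , _) 3≤d d<5 u-alive
  with deg G u ≤? deg G v
... | yes du≤d = du≤d
... | no du≰d  = ⊥-elim (<-irrefl (trans d≡4 (sym du≡4)) d<du)
  where
  no0 : ¬ HasDeg G 0
  no0 = no-low-degree pref 3≤d (s≤s z≤n)
  no1 : ¬ HasDeg G 1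
  no1 = no-low-degree pref 3≤d (s≤s (s≤s z≤n))
  no2 : ¬ HasDeg G 2
  no2 = no-low-degree pref 3≤d ≤-refl
  no5 : ¬ HasDegGe5 G
  no5 h = <⇒≱ d<5 (p5 no0 no1 no2 h)
  d<du : deg G v < deg G u
  d<du = ≰⇒> du≰d
  du≡4 : deg G u ≡ 4
  du≡4 = ≤-antisym (≤-pred (≰⇒> λ 5≤du → no5 (u , u-alive , 5≤du))) (≤-trans (s≤s 3≤d) d<du)
  d≡4 : deg G v ≡ 4
  d≡4 = p4 no0 no1 no2 no5 (u , u-alive , du≡4)

module PreferredIII {n} {G : Graph n} {v : Fin n}
                    (S : IsSimple G) (pref : Preferred G v) (3≤d : 3 ≤ deg G v) where

  private
    G′ : Graph n
    G′ = reduce G v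

    c : ℕ
    c = gain (deg G v)

  Ψ-drop-neighbour : ∀ {u} → adj G v u ≡ true → Ψ (deg G′ u) + c ≤ Ψ (deg G u)
  Ψ-drop-neighbour {u} v∼u = gain≤Ψ-drop 3≤d (min-degree pref 3≤d u-alive)
    (λ d<5 → max-degree pref 3≤d d<5 u-alive) degree-drops
    where
    u-alive : alive G u ≡ true
    u-alive = neighbour-alive S v∼u
    degree-drops : deg G′ u < deg G u
    degree-drops = subst (_≤ deg G u)
      (trans (cong (λ b → deg G′ u + b2n b) (trans (adj-sym S u v) v∼u)) (+-comm (deg G′ u) 1))
      (deg-reduce-nonII G v (3≤⇒≡ᵇ2-false 3≤d) u)

  Ψ-drop-at : ∀ u → Dec (u ≡ v) →
              c * b2n (adj G v u) + Ψ (deg G′ u) + single v (Ψ (deg G v)) u ≤ Ψ (deg G u)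
  Ψ-drop-at u (yes refl)
    rewrite deg-reduce-removed G v | adj-irrefl S v | *-zeroʳ c | single-self v (Ψ (deg G v))
    = ≤-refl
  Ψ-drop-at u (no u≢v) rewrite single-≢ (Ψ (deg G v)) u≢v =
    ≤-trans (≤-reflexive (+-identityʳ _)) (by-adjacency (adj G v u) refl)
    where
    by-adjacency : ∀ b → adj G v u ≡ b → c * b2n b + Ψ (deg G′ u) ≤ Ψ (deg G u)
    by-adjacency false _ = subst (_≤ Ψ (deg G u))
      (cong (_+ Ψ (deg G′ u)) (sym (*-zeroʳ c)))
      (Ψ-mono (deg-reduce-≤ v S u))
    by-adjacency true v∼u = subst (_≤ Ψ (deg G u))
      (trans (+-comm (Ψ (deg G′ u)) c) (cong (_+ Ψ (deg G′ u)) (sym (*-identityʳ c))))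
      (Ψ-drop-neighbour v∼u)

  potential-drop : 20 + potential G′ ≤ potential G
  potential-drop = begin
    20 + potential G′
      ≤⟨ +-monoˡ-≤ (potential G′) (Ψ-gain 3≤d) ⟩
    Ψ (deg G v) + c * deg G v + potential G′
      ≡⟨ xy∙z≈yz∙x (Ψ (deg G v)) (c * deg G v) (potential G′) ⟩
    c * deg G v + potential G′ + Ψ (deg G v)
      ≡⟨ cong (_+ Ψ (deg G v)) split ⟨
    ∑[ u < n ] (c * b2n (adj G v u) + Ψ (deg G′ u)) + Ψ (deg G v)
      ≤⟨ ∑-single-≤ v (Ψ (deg G v)) (λ u → Ψ-drop-at u (u ≟ v)) ⟩
    potential G ∎
    where
    open ≤-Reasoning
    split : ∑[ u < n ] (c * b2n (adj G v u) + Ψ (deg G′ u)) ≡ c * deg G v + potential G′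
    split = trans (∑-distrib-+ (λ u → c * b2n (adj G v u)) (λ u → Ψ (deg G′ u)))
      (cong (_+ potential G′) (trans (sym (*-distribˡ-sum c (λ u → b2n (adj G v u))))
                                     (cong (c *_) (sym (deg≡∑ G v)))))

potential-bounds-III : ∀ {n} {G : Graph n} {vs} → IsSimple G → PrefSeq G vs →
                       20 * numIII G vs ≤ potential G
potential-bounds-III S (done _) = z≤n
potential-bounds-III {G = G} {v ∷ vs} S (step pref rest) with 2 <ᵇ deg G v in isIII
... | false = ≤-trans (potential-bounds-III (reduce-isSimple v S) rest) (potential-reduce-≤ v S)
... | true  = begin
  20 * suc (numIII (reduce G v) vs)   ≡⟨ *-suc 20 (numIII (reduce G v) vs) ⟩
  20 + 20 * numIII (reduce G v) vs    ≤⟨ +-monoʳ-≤ 20 (potential-bounds-III (reduce-isSimple v S) rest) ⟩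
  20 + potential (reduce G v)         ≤⟨ PreferredIII.potential-drop S pref 3≤d ⟩
  potential G                         ∎
  where
  open ≤-Reasoning
  3≤d : 3 ≤ deg G v
  3≤d = <ᵇ⇒< 2 (deg G v) (subst T (sym isIII) tt)

∑-deg≡2*edgeCount : ∀ {n} {a : Fin n → Fin n → Bool} → SimpleAdj n a →
                    ∑[ u < n ] deg (full a) u ≡ 2 * edgeCount a
∑-deg≡2*edgeCount {n} {a} (sym-a , irrefl-a) = begin
  ∑[ i < n ] deg (full a) i
    ≡⟨ sum-cong-≗ (deg≡∑ (full a)) ⟩
  ∑[ i < n ] ∑[ j < n ] b2n (a i j)
    ≡⟨ sum-cong-≗ (λ i → sum-cong-≗ (edge-split i)) ⟩
  ∑[ i < n ] ∑[ j < n ] (e i j + e j i)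
    ≡⟨ sum-cong-≗ (λ i → ∑-distrib-+ (e i) (λ j → e j i)) ⟩
  ∑[ i < n ] (∑[ j < n ] e i j + ∑[ j < n ] e j i)
    ≡⟨ ∑-distrib-+ (λ i → ∑[ j < n ] e i j) (λ i → ∑[ j < n ] e j i) ⟩
  E + ∑[ i < n ] ∑[ j < n ] e j i
    ≡⟨ cong (E +_) (∑-comm (λ i j → e j i)) ⟩
  E + E
    ≡⟨ cong (E +_) (+-identityʳ E) ⟨
  2 * E
    ≡⟨ cong (2 *_) edgeCount≡E ⟨
  2 * edgeCount a ∎
  where
  open ≡-Reasoning
  e : Fin n → Fin n → ℕ
  e i j = b2n (a i j ∧ (toℕ i <ᵇ toℕ j))
  E : ℕ
  E = ∑[ i < n ] ∑[ j < n ] e i j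
  edgeCount≡E : edgeCount a ≡ E
  edgeCount≡E = trans (sum-map-allFin (λ i → sum (map (e i) (allFin n))))
                      (sum-cong-≗ (λ i → sum-map-allFin (e i)))
  -- each edge is counted once, from its endpoint of smaller index
  edge-split : ∀ i j → b2n (a i j) ≡ e i j + e j i
  edge-split i j rewrite sym-a j i with a i j in aij
  ... | false = refl
  ... | true  = sym (b2n-<ᵇ-≢ i≢j)
    where
    i≢j : toℕ i ≢ toℕ j
    i≢j eq = contradiction
      (trans (sym aij) (subst (λ k → a i k ≡ false) (toℕ-injective eq) (irrefl-a i))) λ ()

lemma4 : (n : ℕ) (a : Fin n → Fin n → Bool) → SimpleAdj n a →
         (vs : List (Fin n)) → PrefSeq (full a) vs →
         5 * numIII (full a) vs ≤ edgeCount a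
lemma4 n a simple vs seq = *-cancelˡ-≤ 4 (begin
  4 * (5 * numIII (full a) vs)         ≡⟨ *-assoc 4 5 (numIII (full a) vs) ⟨
  20 * numIII (full a) vs              ≤⟨ potential-bounds-III (full-isSimple simple) seq ⟩
  potential (full a)                   ≤⟨ ∑-mono-≤ (λ u → Ψ≤2* (deg (full a) u)) ⟩
  ∑[ u < n ] (2 * deg (full a) u)      ≡⟨ *-distribˡ-sum 2 (deg (full a)) ⟨
  2 * ∑[ u < n ] deg (full a) u        ≡⟨ cong (2 *_) (∑-deg≡2*edgeCount simple) ⟩
  2 * (2 * edgeCount a)                ≡⟨ *-assoc 2 2 (edgeCount a) ⟨
  4 * edgeCount a                      ∎)
  where open ≤-Reasoning
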